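{- Let $q$ be an even power of an odd prime with $\sqrt{q} \equiv 1 \pmod 4$. In $\mathrm{PG}(2,q)$ let $\mathcal{C}$ be the conic $X_2^2 - X_1X_3 = 0$ and let $\perp$ be the orthogonal polarity defined by $\mathcal{C}$, mapping $P=(x_1,x_2,x_3)$ to the line $P^\perp: x_3X_1 - 2x_2X_2 + x_1X_3 = 0$. Let $K$ be the group of collineations induced by the matrices $$\begin{pmatrix} a^2 & 2ac & c^2 \\ 0 & a & c \\ 0 & 0 & 1 \end{pmatrix},\qquad a,c \in \mathbb{F}_q,\ a^{\sqrt{q}+1}=1.$$ Let $\mathcal{O}$ be any $K$-orbit consisting of internal points of $\mathcal{C}$. Then for every point $P \in \mathcal{O}$, no point of $\mathcal{O}$ lies on the line $P^\perp$.
   Context: A point $(x_1,x_2,x_3)\notin\mathcal{C}$ is internal to $\mathcal{C}$ (lies on no tangent line of $\mathcal{C}$) iff $x_2^2-x_1x_3$ is a non-square in $\mathbb{F}_q$. Points are column vectors and matrices act on the left. -}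

module Defs where

open import Level using (0ℓ)
open import Data.Nat using (ℕ; zero; suc)
open import Data.Fin using (Fin)
open import Data.Product using (_×_; _,_; ∃)
open import Relation.Nullary using (¬_)
open import Algebra.Bundles using (CommutativeRing)
open import Function.Bundles using (Bijection)
import Relation.Binary.PropositionalEquality as ≡

record FiniteField (q : ℕ) : Set₁ where
  field
    commRing : CommutativeRing 0ℓ 0ℓ
  open CommutativeRing commRing public
  field
    0≉1     : ¬ (0# ≈ 1#)
    inverse : ∀ x → ¬ (x ≈ 0#) → ∃ λ y → x * y ≈ 1#
    card    : Bijection setoid (≡.setoid (Fin q))

module _ {q : ℕ} (F : FiniteField q) where
  open FiniteField F

  pow : Carrier → ℕ → Carrier
  pow x zero    = 1#
  pow x (suc n) = x * pow x n

  two : Carrier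
  two = 1# + 1#

  -- homogeneous coordinates (x1,x2,x3) of a point of PG(2,q)
  Vec3 : Set
  Vec3 = Carrier × Carrier × Carrier

  IsPoint : Vec3 → Set
  IsPoint (x₁ , x₂ , x₃) = ¬ (x₁ ≈ 0# × x₂ ≈ 0# × x₃ ≈ 0#)

  IsSquare : Carrier → Set
  IsSquare v = ∃ λ y → y * y ≈ v

  OnConic : Vec3 → Set
  OnConic (x₁ , x₂ , x₃) = x₂ * x₂ - x₁ * x₃ ≈ 0#

  Internal : Vec3 → Set
  Internal x@(x₁ , x₂ , x₃) = ¬ OnConic x × ¬ IsSquare (x₂ * x₂ - x₁ * x₃)

  OnPolar : Vec3 → Vec3 → Set
  OnPolar (p₁ , p₂ , p₃) (y₁ , y₂ , y₃) =
    p₃ * y₁ - two * p₂ * y₂ + p₁ * y₃ ≈ 0#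

  act : Carrier → Carrier → Vec3 → Vec3
  act a c (x₁ , x₂ , x₃) =
    ( a * a * x₁ + two * a * c * x₂ + c * c * x₃
    , a * x₂ + c * x₃
    , x₃ )

  -- (a,c) is a parameter of an element of K : a^(s+1) = 1, where s = sqrt q
  InK : ℕ → Carrier → Carrier → Set
  InK s a c = pow a (suc s) ≈ 1#

-- Write P = (a,c)·x and Q = (a′,c′)·x; both have third coordinate x₃, and the polar form of P
-- and Q equals (P₂ - Q₂)² - V·(x₂² - x₁x₃) with V = a² + a′². So if Q lies on P^⊥, then
-- V·(x₂² - x₁x₃) is a square. Since a^(s+1) = 1 with s = √q ≡ 1 (mod 4), V = 0 would force
-- 1 = (a²)^((s+1)/2) = -(a′²)^((s+1)/2) = -1. By Frobenius,
-- V^s = a^(-2) + a′^(-2) = V / (aa′)², hence V^((q-1)/2) = (aa′)^(-(s+1)) = 1 and V is a square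
-- by Euler's criterion (proved via Wilson's theorem by pairing units). Then x₂² - x₁x₃ is a
-- square, contradicting that x = (1,0)·x is internal.

module Submission where

open import Defs
open import Level using (0ℓ; _⊔_)
open import Algebra.Bundles using (RawRing; CommutativeRing; CommutativeSemiring)
open import Algebra.Solver.Ring.AlmostCommutativeRing using (_-Raw-AlmostCommutative⟶_; fromCommutativeRing)
open import Data.Nat as ℕ using (ℕ; zero; suc; _<_; _∸_; _!; s≤s; z≤n)
import Data.Nat.Properties as ℕ
open import Data.Nat.Divisibility using (_∣_; divides; ∣⇒≤; m∣m*n)
open import Data.Nat.Primality using (Prime; euclidsLemma; prime⇒nonTrivial; ¬prime[0]; ¬prime[1])
open import Data.Nat.Combinatorics using (_C_; nCn≡1; nCk≡n!/k![n-k]!; k![n∸k]!∣n!)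
open import Data.Nat.DivMod using (_/_; m/n*n≡m; m≡m%n+[m/n]*n)
open import Data.Nat.Tactic.RingSolver using (solve-∀)
open import Data.Fin as Fin using (Fin; toℕ; inject₁; fromℕ)
open import Data.Fin.Properties using (toℕ-fromℕ; toℕ-inject₁; toℕ<n; inj⇒≟)
open import Data.Fin.Permutation using (Permutation; permutation)
open import Data.List using (List; []; _∷_; _++_; length; foldr; tabulate)
open import Data.List.Properties using (length-tabulate)
open import Data.List.Relation.Unary.Any using (here; there)
open import Data.List.Relation.Unary.AllPairs using (_∷_)
open import Data.List.Relation.Unary.All.Properties using (All¬⇒¬Any)
open import Data.Maybe using (Maybe; just; nothing)
open import Data.Product using (_,_; ∃; proj₁; proj₂)
open import Data.Sum using (_⊎_; inj₁; inj₂; [_,_]′)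
open import Data.Empty using (⊥-elim)
open import Function using (_∘_; Inverse)
open import Function.Bundles using (Bijection)
open import Function.Properties.Bijection using (Bijection⇒Inverse)
open import Relation.Nullary using (¬_; Dec; yes; no)
open import Relation.Binary.Definitions using (Decidable)
import Relation.Binary.PropositionalEquality as ≡

-- A ring solver with integer coefficients for arbitrary commutative rings

-- Integers as formal differences m ⊝ n, kept in the canonical form where one side is 0,
-- so that the ring solver can compare coefficients syntactically.
record Diff : Set where
  constructor _⊝_
  field pos neg : ℕ

canonical : ℕ → ℕ → Diff
canonical zero    n       = 0 ⊝ n
canonical (suc m) zero    = suc m ⊝ 0
canonical (suc m) (suc n) = canonical m n

diffRing : RawRing 0ℓ 0ℓ
diffRing = record
  { Carrier = Diff
  ; _≈_     = ≡._≡_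
  ; _+_     = λ { (a ⊝ b) (c ⊝ d) → canonical (a ℕ.+ c) (b ℕ.+ d) }
  ; _*_     = λ { (a ⊝ b) (c ⊝ d) → canonical (a ℕ.* c ℕ.+ b ℕ.* d) (a ℕ.* d ℕ.+ b ℕ.* c) }
  ; -_      = λ { (a ⊝ b) → b ⊝ a }
  ; 0#      = 0 ⊝ 0
  ; 1#      = 1 ⊝ 0
  }

module IntegerRingSolver {c ℓ} (R : CommutativeRing c ℓ) where
  open CommutativeRing R hiding (zero)
  open import Algebra.Properties.Ring ring using (-‿anti-homo-+; ⁻¹-anti-homo‿-; -‿distribˡ-*; -‿distribʳ-*; -0#≈0#)
  open import Algebra.Properties.CommutativeSemigroup +-commutativeSemigroup using (interchange)
  open import Algebra.Properties.Semiring.Mult.TCOptimised semiring using (_×_; ×-homo-+; ×1-homo-*)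
  open import Relation.Binary.Reasoning.Setoid setoid

  -- embed (m ⊝ 0) unfolds to the left-nested sum 1# + ⋯ + 1#, so numerals such as 1# + 1# are
  -- matched syntactically by the solver.
  embed : Diff → Carrier
  embed (m ⊝ zero)        = m × 1#
  embed (zero ⊝ suc n)    = - (suc n × 1#)
  embed (suc m ⊝ suc n)   = embed (m ⊝ n)

  private
    ↑_ : ℕ → Carrier
    ↑ n = n × 1#

    difference-+ : ∀ x y z w → (x - y) + (z - w) ≈ (x + z) - (y + w)
    difference-+ x y z w = begin
      (x - y) + (z - w)     ≈⟨ interchange x (- y) z (- w) ⟩
      (x + z) + (- y + - w) ≈⟨ +-congˡ (trans (+-comm _ _) (sym (-‿anti-homo-+ y w))) ⟩
      (x + z) - (y + w)     ∎

    difference-* : ∀ x y z w → (x - y) * (z - w) ≈ (x * z + y * w) - (x * w + y * z)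
    difference-* x y z w = begin
      (x - y) * (z - w)                       ≈⟨ distribʳ (z - w) x (- y) ⟩
      x * (z - w) + - y * (z - w)             ≈⟨ +-congʳ (distribˡ x z (- w)) ⟩
      (x * z + x * - w) + - y * (z - w)       ≈⟨ +-congˡ (trans (sym (-‿distribˡ-* y (z - w))) (-‿cong (distribˡ y z (- w)))) ⟩
      (x * z + x * - w) - (y * z + y * - w)   ≈⟨ +-cong (+-congˡ (sym (-‿distribʳ-* x w))) (-‿cong (+-congˡ (sym (-‿distribʳ-* y w)))) ⟩
      (x * z - x * w) - (y * z - y * w)       ≈⟨ +-congˡ (⁻¹-anti-homo‿- (y * z) (y * w)) ⟩
      (x * z - x * w) + (y * w - y * z)       ≈⟨ difference-+ (x * z) (x * w) (y * w) (y * z) ⟩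
      (x * z + y * w) - (x * w + y * z)       ∎

    ↑-suc-cancel : ∀ m n → ↑ m - ↑ n ≈ ↑ (suc m) - ↑ (suc n)
    ↑-suc-cancel m n = begin
      ↑ m - ↑ n                ≈⟨ +-identityˡ _ ⟨
      0# + (↑ m - ↑ n)         ≈⟨ +-congʳ (-‿inverseʳ 1#) ⟨
      (1# - 1#) + (↑ m - ↑ n)  ≈⟨ difference-+ 1# 1# (↑ m) (↑ n) ⟩
      (1# + ↑ m) - (1# + ↑ n)  ≈⟨ +-cong (×-homo-+ 1# 1 m) (-‿cong (×-homo-+ 1# 1 n)) ⟨
      ↑ (suc m) - ↑ (suc n)    ∎

    embed-⊝ : ∀ m n → embed (m ⊝ n) ≈ ↑ m - ↑ n
    embed-⊝ m       zero    = sym (trans (+-congˡ -0#≈0#) (+-identityʳ _))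
    embed-⊝ zero    (suc n) = sym (+-identityˡ _)
    embed-⊝ (suc m) (suc n) = trans (embed-⊝ m n) (↑-suc-cancel m n)

    embed-canonical : ∀ m n → embed (canonical m n) ≈ ↑ m - ↑ n
    embed-canonical zero    n       = embed-⊝ zero n
    embed-canonical (suc m) zero    = embed-⊝ (suc m) zero
    embed-canonical (suc m) (suc n) = trans (embed-canonical m n) (↑-suc-cancel m n)

  morphism : diffRing -Raw-AlmostCommutative⟶ fromCommutativeRing R
  morphism = record
    { ⟦_⟧    = embed
    ; +-homo = λ { (a ⊝ b) (c ⊝ d) → begin
        embed (canonical (a ℕ.+ c) (b ℕ.+ d))  ≈⟨ embed-canonical (a ℕ.+ c) (b ℕ.+ d) ⟩
        ↑ (a ℕ.+ c) - ↑ (b ℕ.+ d)              ≈⟨ +-cong (×-homo-+ 1# a c) (-‿cong (×-homo-+ 1# b d)) ⟩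
        (↑ a + ↑ c) - (↑ b + ↑ d)              ≈⟨ difference-+ (↑ a) (↑ b) (↑ c) (↑ d) ⟨
        (↑ a - ↑ b) + (↑ c - ↑ d)              ≈⟨ +-cong (embed-⊝ a b) (embed-⊝ c d) ⟨
        embed (a ⊝ b) + embed (c ⊝ d)          ∎ }
    ; *-homo = λ { (a ⊝ b) (c ⊝ d) → begin
        embed (canonical (a ℕ.* c ℕ.+ b ℕ.* d) (a ℕ.* d ℕ.+ b ℕ.* c))
          ≈⟨ embed-canonical (a ℕ.* c ℕ.+ b ℕ.* d) (a ℕ.* d ℕ.+ b ℕ.* c) ⟩
        ↑ (a ℕ.* c ℕ.+ b ℕ.* d) - ↑ (a ℕ.* d ℕ.+ b ℕ.* c)
          ≈⟨ +-cong (↑-+* a c b d) (-‿cong (↑-+* a d b c)) ⟩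
        (↑ a * ↑ c + ↑ b * ↑ d) - (↑ a * ↑ d + ↑ b * ↑ c)
          ≈⟨ difference-* (↑ a) (↑ b) (↑ c) (↑ d) ⟨
        (↑ a - ↑ b) * (↑ c - ↑ d)
          ≈⟨ *-cong (embed-⊝ a b) (embed-⊝ c d) ⟨
        embed (a ⊝ b) * embed (c ⊝ d) ∎ }
    ; -‿homo = λ { (a ⊝ b) → trans (embed-⊝ b a) (sym (trans (-‿cong (embed-⊝ a b)) (⁻¹-anti-homo‿- (↑ a) (↑ b)))) }
    ; 0-homo = refl
    ; 1-homo = refl
    }
    where
    ↑-+* : ∀ a c b d → ↑ (a ℕ.* c ℕ.+ b ℕ.* d) ≈ ↑ a * ↑ c + ↑ b * ↑ d
    ↑-+* a c b d = trans (×-homo-+ 1# (a ℕ.* c) (b ℕ.* d)) (+-cong (×1-homo-* a c) (×1-homo-* b d))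

  coefficient≟ : ∀ x y → Maybe (embed x ≈ embed y)
  coefficient≟ (a ⊝ b) (c ⊝ d) with a ℕ.≟ c | b ℕ.≟ d
  ... | yes ≡.refl | yes ≡.refl = just refl
  ... | _          | _          = nothing

  open import Algebra.Solver.Ring diffRing (fromCommutativeRing R) morphism coefficient≟ public

-- Frobenius

prime∤! : ∀ {p} → Prime p → ∀ {j} → j < p → ¬ p ∣ j !
prime∤! {p} pp {zero} j<p p∣1 = ℕ.<⇒≱ (ℕ.nonTrivial⇒n>1 p {{prime⇒nonTrivial pp}}) (∣⇒≤ p∣1)
prime∤! {p} pp {suc j} j<p p∣j! with euclidsLemma (suc j) (j !) pp p∣j!
... | inj₁ p∣1+j = ℕ.<⇒≱ j<p (∣⇒≤ p∣1+j)
... | inj₂ p∣j!  = prime∤! pp (ℕ.<-trans (ℕ.n<1+n j) j<p) p∣j!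

prime∣C : ∀ {p k} → Prime p → 0 < k → k < p → p ∣ p C k
prime∣C {p@(suc p′)} {k} pp 0<k k<p with euclidsLemma (p C k) (k ! ℕ.* (p ∸ k) !) pp p∣C*!*!
  where
  C*!*!≡! : (p C k) ℕ.* (k ! ℕ.* (p ∸ k) !) ≡.≡ p !
  C*!*!≡! = ≡.trans (≡.cong (ℕ._* (k ! ℕ.* (p ∸ k) !)) (nCk≡n!/k![n-k]! (ℕ.<⇒≤ k<p)))
                    (m/n*n≡m {{ℕ._!*_!≢0 k (p ∸ k)}} (k![n∸k]!∣n! (ℕ.<⇒≤ k<p)))
  p∣C*!*! : p ∣ (p C k) ℕ.* (k ! ℕ.* (p ∸ k) !)
  p∣C*!*! = ≡.subst (p ∣_) (≡.sym C*!*!≡!) (m∣m*n (p′ !))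
... | inj₁ p∣C    = p∣C
... | inj₂ p∣!*! with euclidsLemma (k !) ((p ∸ k) !) pp p∣!*!
...   | inj₁ p∣k!   = ⊥-elim (prime∤! pp k<p p∣k!)
...   | inj₂ p∣p-k! = ⊥-elim (prime∤! pp (ℕ.∸-monoʳ-< 0<k (ℕ.<⇒≤ k<p)) p∣p-k!)

module Frobenius {c ℓ} (S : CommutativeSemiring c ℓ) where
  open CommutativeSemiring S
  open import Algebra.Properties.Semiring.Exp semiring using (_^_; ^-congˡ; ^-assocʳ)
  open import Algebra.Properties.Semiring.Mult semiring using (_×_; ×-assoc-*; ×-congʳ; ×1-homo-*)
  open import Algebra.Properties.Semiring.Sum semiring using (sum; sum-init-last; sum-cong-≋; sum-replicate-zero)
  open import Algebra.Properties.CommutativeSemiring.Binomial S using (binomialTerm; theorem)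
  open import Relation.Binary.Reasoning.Setoid setoid

  ×≈×1* : ∀ n x → n × x ≈ (n × 1#) * x
  ×≈×1* n x = trans (×-congʳ n (sym (*-identityˡ x))) (sym (×-assoc-* n 1# x))

  ×1-homo-^ : ∀ m n → (m ℕ.^ n) × 1# ≈ (m × 1#) ^ n
  ×1-homo-^ m zero    = +-identityʳ 1#
  ×1-homo-^ m (suc n) = trans (×1-homo-* m (m ℕ.^ n)) (*-congˡ (×1-homo-^ m n))

  multiple-of-char-× : ∀ {p} → p × 1# ≈ 0# → ∀ t x → (t ℕ.* p) × x ≈ 0#
  multiple-of-char-× {p} p≈0 t x = begin
    (t ℕ.* p) × x               ≈⟨ ×≈×1* (t ℕ.* p) x ⟩
    ((t ℕ.* p) × 1#) * x        ≈⟨ *-congʳ (×1-homo-* t p) ⟩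
    ((t × 1#) * (p × 1#)) * x   ≈⟨ *-congʳ (*-congˡ p≈0) ⟩
    ((t × 1#) * 0#) * x         ≈⟨ *-congʳ (zeroʳ _) ⟩
    0# * x                      ≈⟨ zeroˡ x ⟩
    0#                          ∎

  frobenius : ∀ {p} → Prime p → p × 1# ≈ 0# → ∀ x y → (x + y) ^ p ≈ x ^ p + y ^ p
  frobenius {p@(suc (suc j))} pp p≈0 x y = begin
    (x + y) ^ p
      ≈⟨ theorem p x y ⟩
    sum term
      ≈⟨ +-congˡ (sum-init-last (λ i → term (Fin.suc i))) ⟩
    term Fin.zero + (sum (λ i → term (Fin.suc (inject₁ i))) + term (Fin.suc (fromℕ (suc j))))
      ≈⟨ +-cong first (+-cong (trans (sum-cong-≋ middle) (sum-replicate-zero (suc j))) last) ⟩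
    y ^ p + (0# + x ^ p)
      ≈⟨ trans (+-congˡ (+-identityˡ _)) (+-comm _ _) ⟩
    x ^ p + y ^ p ∎
    where
    term : Fin (suc p) → Carrier
    term = binomialTerm x y p
    coefficient : ℕ → Carrier
    coefficient k = (p C k) × (x ^ k * y ^ (p ∸ k))
    first : term Fin.zero ≈ y ^ p
    first = trans (+-identityʳ _) (*-identityˡ _)
    last : term (Fin.suc (fromℕ (suc j))) ≈ x ^ p
    last = begin
      term (Fin.suc (fromℕ (suc j))) ≡⟨ ≡.cong (coefficient ∘ suc) (toℕ-fromℕ (suc j)) ⟩
      coefficient p                  ≡⟨ ≡.cong₂ (λ c k → c × (x ^ p * y ^ k)) (nCn≡1 p) (ℕ.n∸n≡0 p) ⟩
      1 × (x ^ p * 1#)               ≈⟨ trans (+-identityʳ _) (*-identityʳ _) ⟩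
      x ^ p                          ∎
    middle : ∀ i → term (Fin.suc (inject₁ i)) ≈ 0#
    middle i with prime∣C {p} {suc (toℕ i)} pp (s≤s z≤n) (s≤s (toℕ<n i))
    ... | divides t C≡t*p = begin
      term (Fin.suc (inject₁ i))  ≡⟨ ≡.cong (coefficient ∘ suc) (toℕ-inject₁ i) ⟩
      coefficient (suc (toℕ i))   ≡⟨ ≡.cong (_× monomial) C≡t*p ⟩
      (t ℕ.* p) × monomial        ≈⟨ multiple-of-char-× p≈0 t monomial ⟩
      0#                          ∎
      where
      monomial : Carrier
      monomial = x ^ suc (toℕ i) * y ^ (p ∸ suc (toℕ i))
  frobenius {0}           pp = ⊥-elim (¬prime[0] pp)
  frobenius {1}           pp = ⊥-elim (¬prime[1] pp)

  frobenius-^ : ∀ {p} → Prime p → p × 1# ≈ 0# → ∀ n x y →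
                (x + y) ^ (p ℕ.^ n) ≈ x ^ (p ℕ.^ n) + y ^ (p ℕ.^ n)
  frobenius-^ pp p≈0 zero    x y = trans (*-identityʳ _) (sym (+-cong (*-identityʳ x) (*-identityʳ y)))
  frobenius-^ {p} pp p≈0 (suc n) x y = begin
    (x + y) ^ (p ℕ.* p ℕ.^ n)                 ≈⟨ ^-assocʳ (x + y) p (p ℕ.^ n) ⟨
    ((x + y) ^ p) ^ (p ℕ.^ n)                 ≈⟨ ^-congˡ (p ℕ.^ n) (frobenius pp p≈0 x y) ⟩
    (x ^ p + y ^ p) ^ (p ℕ.^ n)               ≈⟨ frobenius-^ pp p≈0 n (x ^ p) (y ^ p) ⟩
    (x ^ p) ^ (p ℕ.^ n) + (y ^ p) ^ (p ℕ.^ n) ≈⟨ +-cong (^-assocʳ x p (p ℕ.^ n)) (^-assocʳ y p (p ℕ.^ n)) ⟩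
    x ^ (p ℕ.* p ℕ.^ n) + y ^ (p ℕ.* p ℕ.^ n) ∎

-- Products over lists split into pairs

module Pairing {c ℓ} (S : CommutativeSemiring c ℓ) where
  open CommutativeSemiring S
  open import Algebra.Properties.Semiring.Exp semiring using (_^_)
  open import Data.Product using (_×_)
  open import Data.List.Membership.Setoid setoid using (_∈_; _∉_)
  open import Data.List.Membership.Setoid.Properties using (∈-∃++; ∈-resp-≈)
  open import Data.List.Relation.Unary.Unique.Setoid setoid using (Unique)
  open import Data.List.Relation.Binary.Permutation.Setoid setoid using (_↭_; ↭-refl; ↭-trans; ↭-sym; ↭-reflexive-≋)
  open import Data.List.Relation.Binary.Permutation.Setoid.Properties setoid
    using (shift; ∈-resp-↭; Unique-resp-↭; xs↭ys⇒|xs|≡|ys|; foldr-commMonoid)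
  open import Relation.Binary.Reasoning.Setoid setoid

  product : List Carrier → Carrier
  product = foldr _*_ 1#

  product-↭ : ∀ {xs ys} → xs ↭ ys → product xs ≈ product ys
  product-↭ = foldr-commMonoid *-isCommutativeMonoid

  ∈⇒↭∷ : ∀ {x xs} → x ∈ xs → ∃ λ ys → xs ↭ x ∷ ys
  ∈⇒↭∷ x∈xs with ∈-∃++ setoid x∈xs
  ... | ys , zs , w , x≈w , xs≋ = ys ++ zs , ↭-trans (↭-reflexive-≋ xs≋) (shift (sym x≈w) ys zs)

  ↭∷-unique : ∀ {x xs ys} → Unique xs → xs ↭ x ∷ ys → x ∉ ys × Unique ys
  ↭∷-unique xs-unique xs↭ with Unique-resp-↭ xs↭ xs-unique
  ... | x∉ys ∷ ys-unique = All¬⇒¬Any x∉ys , ys-unique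

  ↭∷-≉ : ∀ {x xs ys y} → Unique xs → xs ↭ x ∷ ys → y ∈ ys → ¬ y ≈ x
  ↭∷-≉ xs-unique xs↭ y∈ys y≈x = proj₁ (↭∷-unique xs-unique xs↭) (∈-resp-≈ setoid y≈x y∈ys)

  ↭∷-⊆ : ∀ {x xs ys y} → xs ↭ x ∷ ys → y ∈ ys → y ∈ xs
  ↭∷-⊆ xs↭ y∈ys = ∈-resp-↭ (↭-sym xs↭) (there y∈ys)

  ↭∷-⊇ : ∀ {x xs ys y} → xs ↭ x ∷ ys → y ∈ xs → ¬ y ≈ x → y ∈ ys
  ↭∷-⊇ xs↭ y∈xs y≉x with ∈-resp-↭ xs↭ y∈xs
  ... | here y≈x   = ⊥-elim (y≉x y≈x)
  ... | there y∈ys = y∈ys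

  module _ (ι : Carrier → Carrier) (ι-cong : ∀ {x y} → x ≈ y → ι x ≈ ι y) (v : Carrier) where

    record PairedBy (xs : List Carrier) : Set (c ⊔ ℓ) where
      field
        unique       : Unique xs
        closed       : ∀ {x} → x ∈ xs → ι x ∈ xs
        involutive   : ∀ {x} → x ∈ xs → ι (ι x) ≈ x
        no-fixpoint  : ∀ {x} → x ∈ xs → ¬ ι x ≈ x
        pair-product : ∀ {x} → x ∈ xs → x * ι x ≈ v

    drop-pair : ∀ {x xs ys} → PairedBy (x ∷ xs) → xs ↭ ι x ∷ ys → PairedBy ys
    drop-pair {x} {xs} {ys} P xs↭ = record
      { unique       = proj₂ (↭∷-unique xs-unique xs↭)
      ; closed       = closed′
      ; involutive   = λ y∈ys → involutive (ys⊆x∷xs y∈ys)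
      ; no-fixpoint  = λ y∈ys → no-fixpoint (ys⊆x∷xs y∈ys)
      ; pair-product = λ y∈ys → pair-product (ys⊆x∷xs y∈ys)
      }
      where
      open PairedBy P
      x∉xs : x ∉ xs
      x∉xs = proj₁ (↭∷-unique unique ↭-refl)
      xs-unique : Unique xs
      xs-unique = proj₂ (↭∷-unique unique ↭-refl)
      ys⊆x∷xs : ∀ {y} → y ∈ ys → y ∈ x ∷ xs
      ys⊆x∷xs y∈ys = there (↭∷-⊆ xs↭ y∈ys)
      closed′ : ∀ {y} → y ∈ ys → ι y ∈ ys
      closed′ {y} y∈ys with closed (ys⊆x∷xs y∈ys)
      ... | here ιy≈x = ⊥-elim (proj₁ (↭∷-unique xs-unique xs↭) (∈-resp-≈ setoid y≈ιx y∈ys))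
        where
        y≈ιx : y ≈ ι x
        y≈ιx = trans (sym (involutive (ys⊆x∷xs y∈ys))) (ι-cong ιy≈x)
      ... | there ιy∈xs = ↭∷-⊇ xs↭ ιy∈xs λ ιy≈ιx → x∉xs (∈-resp-≈ setoid (y≈x ιy≈ιx) (↭∷-⊆ xs↭ y∈ys))
        where
        y≈x : ι y ≈ ι x → y ≈ x
        y≈x ιy≈ιx = trans (sym (involutive (ys⊆x∷xs y∈ys))) (trans (ι-cong ιy≈ιx) (involutive (here refl)))

    paired-product : ∀ {xs} → PairedBy xs → ∃ λ k → length xs ≡.≡ k ℕ.+ k × product xs ≈ v ^ k
    paired-product {xs} = go (length xs) xs ≡.refl
      where
      go : ∀ n xs → length xs ≡.≡ n → PairedBy xs → ∃ λ k → n ≡.≡ k ℕ.+ k × product xs ≈ v ^ k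
      go zero          []       _   _ = 0 , ≡.refl , refl
      go (suc zero)    (x ∷ []) _   P with PairedBy.closed P (here refl)
      ... | here ιx≈x = ⊥-elim (PairedBy.no-fixpoint P (here refl) ιx≈x)
      go (suc (suc n)) (x ∷ xs) len P with PairedBy.closed P (here refl)
      ... | here ιx≈x = ⊥-elim (PairedBy.no-fixpoint P (here refl) ιx≈x)
      ... | there ιx∈xs with ∈⇒↭∷ ιx∈xs
      ...   | ys , xs↭ with go n ys ys-length (drop-pair P xs↭)
        where
        ys-length : length ys ≡.≡ n
        ys-length = ℕ.suc-injective (≡.trans (≡.sym (xs↭ys⇒|xs|≡|ys| xs↭)) (ℕ.suc-injective len))
      ...     | k , n≡k+k , ys-product = suc k , ≡.cong suc (≡.trans (≡.cong suc n≡k+k) (≡.sym (ℕ.+-suc k k))) , (begin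
        x * product xs              ≈⟨ *-congˡ (product-↭ xs↭) ⟩
        x * (ι x * product ys)      ≈⟨ *-assoc x (ι x) (product ys) ⟨
        (x * ι x) * product ys      ≈⟨ *-cong (PairedBy.pair-product P (here refl)) ys-product ⟩
        v * v ^ k                   ∎)

-- Finite fields: inverses, characteristic, Wilson and Euler

module FiniteFieldProperties {q : ℕ} (F : FiniteField q) where
  open FiniteField F
  open import Algebra.Properties.Ring ring using (-‿involutive; -0#≈0#; x∙y⁻¹≈ε⇒x≈y; +-identityʳ-unique)
  open import Algebra.Properties.Semiring.Exp semiring using (_^_)
  open import Algebra.Properties.Semiring.Mult semiring using (_×_; ×-homo-+)
  open import Algebra.Properties.Semiring.Sum semiring using (sum; sum-permute; sum-cong-≋; ∑-distrib-+; sum-replicate)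
  open import Data.List.Membership.Setoid setoid using (_∈_)
  open import Data.List.Membership.Setoid.Properties using (∈-tabulate⁺; ∈-resp-≈)
  open import Data.List.Relation.Unary.Unique.Setoid setoid using (Unique)
  import Data.List.Relation.Unary.Unique.Setoid.Properties as Unique
  open import Data.List.Relation.Binary.Permutation.Setoid setoid using (_↭_)
  open import Data.List.Relation.Binary.Permutation.Setoid.Properties setoid
    using (xs↭ys⇒|xs|≡|ys|)
  open IntegerRingSolver commRing using (solve; _:=_; _:+_; _:*_; _:-_; :-_; con)
  open Pairing commutativeSemiring
  open Frobenius commutativeSemiring using (×1-homo-^)
  open import Relation.Binary.Reasoning.Setoid setoid

  _≟_ : Decidable _≈_
  _≟_ = inj⇒≟ (Bijection.injection card)

  x*y≈0⇒y≈0 : ∀ {x y} → ¬ x ≈ 0# → x * y ≈ 0# → y ≈ 0#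
  x*y≈0⇒y≈0 {x} {y} x≉0 xy≈0 with inverse x x≉0
  ... | x′ , xx′≈1 = begin
    y              ≈⟨ *-identityˡ y ⟨
    1# * y         ≈⟨ *-congʳ xx′≈1 ⟨
    (x * x′) * y   ≈⟨ solve 3 (λ x x′ y → (x :* x′) :* y := x′ :* (x :* y)) refl x x′ y ⟩
    x′ * (x * y)   ≈⟨ *-congˡ xy≈0 ⟩
    x′ * 0#        ≈⟨ zeroʳ x′ ⟩
    0#             ∎

  x*x≈0⇒x≈0 : ∀ {x} → x * x ≈ 0# → x ≈ 0#
  x*x≈0⇒x≈0 {x} xx≈0 with x ≟ 0#
  ... | yes x≈0 = x≈0
  ... | no  x≉0 = x*y≈0⇒y≈0 x≉0 xx≈0

  x^n≈0⇒x≈0 : ∀ {x} n → x ^ n ≈ 0# → x ≈ 0#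
  x^n≈0⇒x≈0     zero    1≈0 = ⊥-elim (0≉1 (sym 1≈0))
  x^n≈0⇒x≈0 {x} (suc n) xxⁿ≈0 with x ≟ 0#
  ... | yes x≈0 = x≈0
  ... | no  x≉0 = x^n≈0⇒x≈0 n (x*y≈0⇒y≈0 x≉0 xxⁿ≈0)

  1≉0 : ¬ 1# ≈ 0#
  1≉0 1≈0 = 0≉1 (sym 1≈0)

  -1≉0 : ¬ - 1# ≈ 0#
  -1≉0 -1≈0 = 1≉0 (trans (sym (-‿involutive 1#)) (trans (-‿cong -1≈0) -0#≈0#))

  x*x≈1⇒x≈±1 : ∀ {x} → x * x ≈ 1# → x ≈ 1# ⊎ x ≈ - 1#
  x*x≈1⇒x≈±1 {x} xx≈1 with x ≟ 1#
  ... | yes x≈1 = inj₁ x≈1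
  ... | no  x≉1 = inj₂ (x∙y⁻¹≈ε⇒x≈y x (- 1#) (trans (+-congˡ (-‿involutive 1#))
                    (x*y≈0⇒y≈0 (λ x-1≈0 → x≉1 (x∙y⁻¹≈ε⇒x≈y x 1# x-1≈0)) (begin
      (x - 1#) * (x + 1#) ≈⟨ solve 1 (λ x → (x :- con (1 ⊝ 0)) :* (x :+ con (1 ⊝ 0)) := x :* x :- con (1 ⊝ 0)) refl x ⟩
      x * x - 1#          ≈⟨ +-congʳ xx≈1 ⟩
      1# - 1#             ≈⟨ -‿inverseʳ 1# ⟩
      0#                  ∎))))

  1^n≈1 : ∀ n → 1# ^ n ≈ 1#
  1^n≈1 zero    = refl
  1^n≈1 (suc n) = trans (*-identityˡ _) (1^n≈1 n)

  pow≈^ : ∀ x n → pow F x n ≈ x ^ n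
  pow≈^ x zero    = refl
  pow≈^ x (suc n) = *-congˡ (pow≈^ x n)

  infix 8 _⁻¹
  _⁻¹ : Carrier → Carrier
  x ⁻¹ with x ≟ 0#
  ... | yes _   = 0#
  ... | no  x≉0 = proj₁ (inverse x x≉0)

  ⁻¹-zero : ∀ {x} → x ≈ 0# → x ⁻¹ ≈ 0#
  ⁻¹-zero {x} x≈0 with x ≟ 0#
  ... | yes _   = refl
  ... | no  x≉0 = ⊥-elim (x≉0 x≈0)

  ⁻¹-inverseʳ : ∀ {x} → ¬ x ≈ 0# → x * x ⁻¹ ≈ 1#
  ⁻¹-inverseʳ {x} x≉0 with x ≟ 0#
  ... | yes x≈0 = ⊥-elim (x≉0 x≈0)
  ... | no  x≉0 = proj₂ (inverse x x≉0)

  ⁻¹-inverseˡ : ∀ {x} → ¬ x ≈ 0# → x ⁻¹ * x ≈ 1#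
  ⁻¹-inverseˡ x≉0 = trans (*-comm _ _) (⁻¹-inverseʳ x≉0)

  x*y≈1⇒x≉0 : ∀ {x y} → x * y ≈ 1# → ¬ x ≈ 0#
  x*y≈1⇒x≉0 {x} {y} xy≈1 x≈0 = 0≉1 (trans (sym (zeroˡ y)) (trans (*-congʳ (sym x≈0)) xy≈1))

  x*y≈1⇒y≈x⁻¹ : ∀ {x y} → x * y ≈ 1# → y ≈ x ⁻¹
  x*y≈1⇒y≈x⁻¹ {x} {y} xy≈1 = begin
    y                ≈⟨ *-identityˡ y ⟨
    1# * y           ≈⟨ *-congʳ (⁻¹-inverseˡ (x*y≈1⇒x≉0 xy≈1)) ⟨
    (x ⁻¹ * x) * y   ≈⟨ *-assoc (x ⁻¹) x y ⟩
    x ⁻¹ * (x * y)   ≈⟨ *-congˡ xy≈1 ⟩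
    x ⁻¹ * 1#        ≈⟨ *-identityʳ (x ⁻¹) ⟩
    x ⁻¹             ∎

  ⁻¹-cong : ∀ {x y} → x ≈ y → x ⁻¹ ≈ y ⁻¹
  ⁻¹-cong {x} {y} x≈y = by-cases (x ≟ 0#)
    where
    by-cases : Dec (x ≈ 0#) → x ⁻¹ ≈ y ⁻¹
    by-cases (yes x≈0) = trans (⁻¹-zero x≈0) (sym (⁻¹-zero (trans (sym x≈y) x≈0)))
    by-cases (no  x≉0) = x*y≈1⇒y≈x⁻¹ (trans (*-congʳ (sym x≈y)) (⁻¹-inverseʳ x≉0))

  ⁻¹-nonzero : ∀ {x} → ¬ x ≈ 0# → ¬ x ⁻¹ ≈ 0#
  ⁻¹-nonzero x≉0 = x*y≈1⇒x≉0 (⁻¹-inverseˡ x≉0)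

  ⁻¹-involutive : ∀ {x} → ¬ x ≈ 0# → x ⁻¹ ⁻¹ ≈ x
  ⁻¹-involutive x≉0 = sym (x*y≈1⇒y≈x⁻¹ (⁻¹-inverseˡ x≉0))

  ⁻¹-injective : ∀ {x y} → ¬ x ≈ 0# → ¬ y ≈ 0# → x ⁻¹ ≈ y ⁻¹ → x ≈ y
  ⁻¹-injective x≉0 y≉0 x⁻¹≈y⁻¹ =
    trans (sym (⁻¹-involutive x≉0)) (trans (⁻¹-cong x⁻¹≈y⁻¹) (⁻¹-involutive y≉0))

  private
    module Card = Inverse (Bijection⇒Inverse card)

  elements : List Carrier
  elements = tabulate Card.from

  elements-unique : Unique elements
  elements-unique = Unique.tabulate⁺ setoid λ {i} {j} fi≈fj →
    ≡.trans (≡.sym (Card.inverseˡ refl)) (≡.trans (Card.to-cong fi≈fj) (Card.inverseˡ refl))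

  ∈-elements : ∀ x → x ∈ elements
  ∈-elements x = ∈-resp-≈ setoid (Card.inverseʳ ≡.refl) (∈-tabulate⁺ setoid (Card.to x))

  -- Translation by 1# permutes the field, so Σ x = Σ (x + 1#) = Σ x + q × 1#.
  characteristic : q × 1# ≈ 0#
  characteristic = +-identityʳ-unique (sum Card.from) (q × 1#) (sym (begin
    sum Card.from                         ≈⟨ sum-permute Card.from shift ⟩
    sum (λ i → Card.from (Card.to (Card.from i + 1#)))
                                          ≈⟨ sum-cong-≋ {q} (λ i → Card.inverseʳ ≡.refl) ⟩
    sum (λ i → Card.from i + 1#)          ≈⟨ ∑-distrib-+ Card.from (λ _ → 1#) ⟩
    sum Card.from + sum {q} (λ _ → 1#)    ≈⟨ +-congˡ (sum-replicate q) ⟩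
    sum Card.from + q × 1#                ∎))
    where
    translate-back : ∀ t u → Card.to (Card.from (Card.to (t + u)) - u) ≡.≡ Card.to t
    translate-back t u = Card.to-cong (trans (+-congʳ (Card.inverseʳ ≡.refl))
      (solve 2 (λ t u → (t :+ u) :- u := t) refl t u))
    translate-forth : ∀ t u → Card.to (Card.from (Card.to (t - u)) + u) ≡.≡ Card.to t
    translate-forth t u = Card.to-cong (trans (+-congʳ (Card.inverseʳ ≡.refl))
      (solve 2 (λ t u → (t :- u) :+ u := t) refl t u))
    shift : Permutation q q
    shift = permutation (λ i → Card.to (Card.from i + 1#)) (λ i → Card.to (Card.from i - 1#))
      (λ i → ≡.trans (translate-forth (Card.from i) 1#) (Card.inverseˡ refl))
      (λ i → ≡.trans (translate-back (Card.from i) 1#) (Card.inverseˡ refl))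

  prime-power-characteristic : ∀ p n → q ≡.≡ p ℕ.^ n → p × 1# ≈ 0#
  prime-power-characteristic p n q≡pⁿ =
    x^n≈0⇒x≈0 n (trans (sym (×1-homo-^ p n)) (≡.subst (λ m → m × 1# ≈ 0#) q≡pⁿ characteristic))

  odd-char⇒1≉-1 : ∀ n → suc (n ℕ.+ n) × 1# ≈ 0# → ¬ 1# ≈ - 1#
  odd-char⇒1≉-1 n [1+2n]≈0 1≈-1 = 1≉0 (begin
    1#                           ≈⟨ +-identityʳ 1# ⟨
    1# + 0#                      ≈⟨ +-congˡ (trans (×-homo-+ 1# n n) 2n≈0) ⟨
    1# + (n ℕ.+ n) × 1#          ≈⟨ [1+2n]≈0 ⟩
    0#                           ∎)
    where
    2n≈0 : n × 1# + n × 1# ≈ 0#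
    2n≈0 = begin
      n × 1# + n × 1#            ≈⟨ solve 1 (λ m → m :+ m := m :* (con (1 ⊝ 0) :+ con (1 ⊝ 0))) refl (n × 1#) ⟩
      n × 1# * (1# + 1#)         ≈⟨ *-congˡ (trans (+-congˡ 1≈-1) (-‿inverseʳ 1#)) ⟩
      n × 1# * 0#                ≈⟨ zeroʳ _ ⟩
      0#                         ∎

  units : List Carrier
  units = proj₁ (∈⇒↭∷ (∈-elements 0#))

  private
    elements↭ : elements ↭ 0# ∷ units
    elements↭ = proj₂ (∈⇒↭∷ (∈-elements 0#))

  units-unique : Unique units
  units-unique = proj₂ (↭∷-unique elements-unique elements↭)

  ∈-units : ∀ {x} → ¬ x ≈ 0# → x ∈ units
  ∈-units x≉0 = ↭∷-⊇ elements↭ (∈-elements _) x≉0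

  units-nonzero : ∀ {x} → x ∈ units → ¬ x ≈ 0#
  units-nonzero = ↭∷-≉ elements-unique elements↭

  length-units : suc (length units) ≡.≡ q
  length-units = ≡.trans (≡.sym (xs↭ys⇒|xs|≡|ys| elements↭)) (length-tabulate Card.from)

  cofactor : Carrier → Carrier → Carrier
  cofactor v x = v * x ⁻¹

  cofactor-cong : ∀ v {x y} → x ≈ y → cofactor v x ≈ cofactor v y
  cofactor-cong v x≈y = *-congˡ (⁻¹-cong x≈y)

  module _ {v} (v≉0 : ¬ v ≈ 0#) where

    cofactor-nonzero : ∀ {x} → ¬ x ≈ 0# → ¬ cofactor v x ≈ 0#
    cofactor-nonzero x≉0 vx⁻¹≈0 = ⁻¹-nonzero x≉0 (x*y≈0⇒y≈0 v≉0 vx⁻¹≈0)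

    x*cofactor≈v : ∀ {x} → ¬ x ≈ 0# → x * cofactor v x ≈ v
    x*cofactor≈v {x} x≉0 = begin
      x * (v * x ⁻¹)   ≈⟨ solve 3 (λ x v y → x :* (v :* y) := v :* (x :* y)) refl x v (x ⁻¹) ⟩
      v * (x * x ⁻¹)   ≈⟨ *-congˡ (⁻¹-inverseʳ x≉0) ⟩
      v * 1#           ≈⟨ *-identityʳ v ⟩
      v                ∎

    cofactor-involutive : ∀ {x} → ¬ x ≈ 0# → cofactor v (cofactor v x) ≈ x
    cofactor-involutive {x} x≉0 = begin
      v * (cofactor v x) ⁻¹  ≈⟨ *-congˡ (x*y≈1⇒y≈x⁻¹ cofactor*x/v≈1) ⟨
      v * (x * v ⁻¹)         ≈⟨ solve 3 (λ v x y → v :* (x :* y) := x :* (v :* y)) refl v x (v ⁻¹) ⟩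
      x * (v * v ⁻¹)         ≈⟨ *-congˡ (⁻¹-inverseʳ v≉0) ⟩
      x * 1#                 ≈⟨ *-identityʳ x ⟩
      x                      ∎
      where
      cofactor*x/v≈1 : cofactor v x * (x * v ⁻¹) ≈ 1#
      cofactor*x/v≈1 = begin
        cofactor v x * (x * v ⁻¹)   ≈⟨ solve 3 (λ y x z → y :* (x :* z) := (x :* y) :* z) refl (cofactor v x) x (v ⁻¹) ⟩
        (x * cofactor v x) * v ⁻¹   ≈⟨ *-congʳ (x*cofactor≈v x≉0) ⟩
        v * v ⁻¹                    ≈⟨ ⁻¹-inverseʳ v≉0 ⟩
        1#                          ∎

  -- A cofactor pair {x, v x⁻¹} degenerates only when x² = v.
  nonsquare-pairing : ∀ {v} → ¬ IsSquare F v → PairedBy (cofactor v) (cofactor-cong v) v units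
  nonsquare-pairing {v} v-nonsquare = record
    { unique       = units-unique
    ; closed       = λ x∈ → ∈-units (cofactor-nonzero v≉0 (units-nonzero x∈))
    ; involutive   = λ x∈ → cofactor-involutive v≉0 (units-nonzero x∈)
    ; no-fixpoint  = λ {x} x∈ vx⁻¹≈x → v-nonsquare (x , trans (*-congˡ (sym vx⁻¹≈x)) (x*cofactor≈v v≉0 (units-nonzero x∈)))
    ; pair-product = λ x∈ → x*cofactor≈v v≉0 (units-nonzero x∈)
    }
    where
    v≉0 : ¬ v ≈ 0#
    v≉0 v≈0 = v-nonsquare (0# , trans (zeroˡ 0#) (sym v≈0))

  module _ (1≉-1 : ¬ 1# ≈ - 1#) where

    private
      units∖1 : List Carrier
      units∖1 = proj₁ (∈⇒↭∷ (∈-units 1≉0))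

      units↭ : units ↭ 1# ∷ units∖1
      units↭ = proj₂ (∈⇒↭∷ (∈-units 1≉0))

      -1∈units∖1 : - 1# ∈ units∖1
      -1∈units∖1 = ↭∷-⊇ units↭ (∈-units -1≉0) (λ -1≈1 → 1≉-1 (sym -1≈1))

      units∖±1 : List Carrier
      units∖±1 = proj₁ (∈⇒↭∷ -1∈units∖1)

      units∖1↭ : units∖1 ↭ - 1# ∷ units∖±1
      units∖1↭ = proj₂ (∈⇒↭∷ -1∈units∖1)

      units∖1-unique : Unique units∖1
      units∖1-unique = proj₂ (↭∷-unique units-unique units↭)

      units∖±1-nonzero : ∀ {y} → y ∈ units∖±1 → ¬ y ≈ 0#
      units∖±1-nonzero y∈ = units-nonzero (↭∷-⊆ units↭ (↭∷-⊆ units∖1↭ y∈))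

      units∖±1-≉1 : ∀ {y} → y ∈ units∖±1 → ¬ y ≈ 1#
      units∖±1-≉1 y∈ = ↭∷-≉ units-unique units↭ (↭∷-⊆ units∖1↭ y∈)

      units∖±1-≉-1 : ∀ {y} → y ∈ units∖±1 → ¬ y ≈ - 1#
      units∖±1-≉-1 = ↭∷-≉ units∖1-unique units∖1↭

      inverse-pairing : PairedBy _⁻¹ ⁻¹-cong 1# units∖±1
      inverse-pairing = record
        { unique       = proj₂ (↭∷-unique units∖1-unique units∖1↭)
        ; closed       = λ {y} y∈ → ↭∷-⊇ units∖1↭
            (↭∷-⊇ units↭ (∈-units (⁻¹-nonzero (units∖±1-nonzero y∈)))
              (λ y⁻¹≈1 → units∖±1-≉1 y∈ (⁻¹-injective (units∖±1-nonzero y∈) 1≉0 (trans y⁻¹≈1 1≈1⁻¹))))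
            (λ y⁻¹≈-1 → units∖±1-≉-1 y∈ (⁻¹-injective (units∖±1-nonzero y∈) -1≉0 (trans y⁻¹≈-1 -1≈-1⁻¹)))
        ; involutive   = λ y∈ → ⁻¹-involutive (units∖±1-nonzero y∈)
        ; no-fixpoint  = λ {y} y∈ y⁻¹≈y → [ units∖±1-≉1 y∈ , units∖±1-≉-1 y∈ ]′
            (x*x≈1⇒x≈±1 (trans (*-congˡ (sym y⁻¹≈y)) (⁻¹-inverseʳ (units∖±1-nonzero y∈))))
        ; pair-product = λ y∈ → ⁻¹-inverseʳ (units∖±1-nonzero y∈)
        }
        where
        1≈1⁻¹ : 1# ≈ 1# ⁻¹
        1≈1⁻¹ = x*y≈1⇒y≈x⁻¹ (*-identityˡ 1#)
        -1≈-1⁻¹ : - 1# ≈ (- 1#) ⁻¹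
        -1≈-1⁻¹ = x*y≈1⇒y≈x⁻¹ (solve 0 (:- con (1 ⊝ 0) :* :- con (1 ⊝ 0) := con (1 ⊝ 0)) refl)

    wilson : product units ≈ - 1#
    wilson = begin
      product units                   ≈⟨ product-↭ units↭ ⟩
      1# * product units∖1            ≈⟨ *-congˡ (product-↭ units∖1↭) ⟩
      1# * (- 1# * product units∖±1)  ≈⟨ *-congˡ (*-congˡ (trans product≈1^k (1^n≈1 k))) ⟩
      1# * (- 1# * 1#)                ≈⟨ trans (*-identityˡ _) (*-identityʳ _) ⟩
      - 1#                            ∎
      where
      k : ℕ
      k = proj₁ (paired-product _⁻¹ ⁻¹-cong 1# inverse-pairing)
      product≈1^k : product units∖±1 ≈ 1# ^ k
      product≈1^k = proj₂ (proj₂ (paired-product _⁻¹ ⁻¹-cong 1# inverse-pairing))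

    euler : ∀ {v} k → suc (k ℕ.+ k) ≡.≡ q → ¬ IsSquare F v → v ^ k ≈ - 1#
    euler {v} k q≡1+2k v-nonsquare = begin
      v ^ k           ≡⟨ ≡.cong (v ^_) k≡j ⟩
      v ^ j           ≈⟨ product≈v^j ⟨
      product units   ≈⟨ wilson ⟩
      - 1#            ∎
      where
      pairing : PairedBy (cofactor v) (cofactor-cong v) v units
      pairing = nonsquare-pairing v-nonsquare
      j : ℕ
      j = proj₁ (paired-product (cofactor v) (cofactor-cong v) v pairing)
      units≡j+j : length units ≡.≡ j ℕ.+ j
      units≡j+j = proj₁ (proj₂ (paired-product (cofactor v) (cofactor-cong v) v pairing))
      product≈v^j : product units ≈ v ^ j
      product≈v^j = proj₂ (proj₂ (paired-product (cofactor v) (cofactor-cong v) v pairing))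
      k≡j : k ≡.≡ j
      k≡j = ≡.trans (ℕ.n≡⌊n+n/2⌋ k) (≡.trans (≡.cong ℕ.⌊_/2⌋ k+k≡j+j) (≡.sym (ℕ.n≡⌊n+n/2⌋ j)))
        where
        k+k≡j+j : k ℕ.+ k ≡.≡ j ℕ.+ j
        k+k≡j+j = ≡.trans (ℕ.suc-injective (≡.trans q≡1+2k (≡.sym length-units))) units≡j+j

-- The conic, its polarity and the group K

module Geometry {q : ℕ} (F : FiniteField q) where
  open FiniteField F
  open FiniteFieldProperties F using (_⁻¹; ⁻¹-inverseʳ)
  open IntegerRingSolver commRing using (solve; _:=_; _:+_; _:*_; _:-_; con)
  open import Algebra.Properties.Ring ring using (x∙y⁻¹≈ε⇒x≈y)
  open import Relation.Binary.Reasoning.Setoid setoid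

  disc : Vec3 F → Carrier
  disc (x₁ , x₂ , x₃) = x₂ * x₂ - x₁ * x₃

  second : Vec3 F → Carrier
  second (_ , x₂ , _) = x₂

  disc-act : ∀ a c x → disc (act F a c x) ≈ a * a * disc x
  disc-act a c (x₁ , x₂ , x₃) = solve 5 (λ a c x₁ x₂ x₃ →
      (a :* x₂ :+ c :* x₃) :* (a :* x₂ :+ c :* x₃)
        :- (a :* a :* x₁ :+ con (2 ⊝ 0) :* a :* c :* x₂ :+ c :* c :* x₃) :* x₃
    := a :* a :* (x₂ :* x₂ :- x₁ :* x₃)) refl a c x₁ x₂ x₃

  -- The polar form of two K-images of x, which share their third coordinate, is
  -- (P₂ - Q₂)² - (a² + a′²) disc x.
  onPolar⇒square : ∀ a c a′ c′ x → OnPolar F (act F a c x) (act F a′ c′ x) →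
    (second (act F a c x) - second (act F a′ c′ x)) * (second (act F a c x) - second (act F a′ c′ x))
      ≈ (a * a + a′ * a′) * disc x
  onPolar⇒square a c a′ c′ (x₁ , x₂ , x₃) polar = x∙y⁻¹≈ε⇒x≈y _ _ (trans (sym (solve 7 (λ a c a′ c′ x₁ x₂ x₃ →
      x₃ :* (a′ :* a′ :* x₁ :+ con (2 ⊝ 0) :* a′ :* c′ :* x₂ :+ c′ :* c′ :* x₃)
        :- con (2 ⊝ 0) :* (a :* x₂ :+ c :* x₃) :* (a′ :* x₂ :+ c′ :* x₃)
        :+ (a :* a :* x₁ :+ con (2 ⊝ 0) :* a :* c :* x₂ :+ c :* c :* x₃) :* x₃
    := ((a :* x₂ :+ c :* x₃) :- (a′ :* x₂ :+ c′ :* x₃)) :* ((a :* x₂ :+ c :* x₃) :- (a′ :* x₂ :+ c′ :* x₃))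
        :- (a :* a :+ a′ :* a′) :* (x₂ :* x₂ :- x₁ :* x₃)) refl a c a′ c′ x₁ x₂ x₃)) polar)

  square-ratio : ∀ {u v d} → ¬ v ≈ 0# → IsSquare F v → u * u ≈ v * d → IsSquare F d
  square-ratio {u} {v} {d} v≉0 (w , ww≈v) uu≈vd = u * w ⁻¹ , (begin
    (u * w ⁻¹) * (u * w ⁻¹)        ≈⟨ solve 2 (λ u y → (u :* y) :* (u :* y) := (u :* u) :* (y :* y)) refl u (w ⁻¹) ⟩
    (u * u) * (w ⁻¹ * w ⁻¹)        ≈⟨ *-congʳ (trans uu≈vd (*-congʳ (sym ww≈v))) ⟩
    ((w * w) * d) * (w ⁻¹ * w ⁻¹)  ≈⟨ solve 3 (λ w d y → ((w :* w) :* d) :* (y :* y) := d :* ((w :* y) :* (w :* y))) refl w d (w ⁻¹) ⟩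
    d * ((w * w ⁻¹) * (w * w ⁻¹))  ≈⟨ *-congˡ (*-cong (⁻¹-inverseʳ w≉0) (⁻¹-inverseʳ w≉0)) ⟩
    d * (1# * 1#)                  ≈⟨ trans (*-congˡ (*-identityʳ 1#)) (*-identityʳ d) ⟩
    d                              ∎)
    where
    w≉0 : ¬ w ≈ 0#
    w≉0 w≈0 = v≉0 (trans (sym ww≈v) (trans (*-congʳ w≈0) (zeroˡ w)))

module NormOneSquares {q : ℕ} (F : FiniteField q) where
  open FiniteField F
  open FiniteFieldProperties F using (euler; x*y≈0⇒y≈0; x*x≈0⇒x≈0; characteristic; odd-char⇒1≉-1; 1^n≈1)
  open IntegerRingSolver commRing using (solve; _:=_; _:+_; _:*_; _:-_; :-_; con)
  open import Algebra.Properties.Ring ring using (x∙y⁻¹≈ε⇒x≈y)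
  open import Algebra.Properties.Semiring.Exp semiring using (_^_; ^-congˡ; ^-homo-*; ^-assocʳ)
  open import Algebra.Properties.CommutativeSemiring.Exp commutativeSemiring using (^-distrib-*)
  open import Algebra.Properties.Semiring.Mult semiring using (_×_; ×1-homo-*)
  open import Relation.Binary.Reasoning.Setoid setoid

  -- F is the quadratic extension of the subfield of order s = 1 + 4t, and a ^ (s + 1) = 1 says
  -- that a has norm one.
  module QuadraticExtension {s : ℕ} (t : ℕ) (s≡1+4t : s ≡.≡ suc (t ℕ.* 4)) (q≡s*s : q ≡.≡ s ℕ.* s)
           (frobenius-s : ∀ x y → (x + y) ^ s ≈ x ^ s + y ^ s) where

    private
      r m : ℕ
      r = t ℕ.* 4
      m = suc (2 ℕ.* t)

      1+s≡m+m : suc s ≡.≡ m ℕ.+ m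
      1+s≡m+m = ≡.trans (≡.cong suc s≡1+4t) (lemma t)
        where
        lemma : ∀ t → suc (suc (t ℕ.* 4)) ≡.≡ suc (2 ℕ.* t) ℕ.+ suc (2 ℕ.* t)
        lemma = solve-∀

      q≡1+2rm : q ≡.≡ suc (r ℕ.* m ℕ.+ r ℕ.* m)
      q≡1+2rm = ≡.trans q≡s*s (≡.trans (≡.cong (λ n → n ℕ.* n) s≡1+4t) (lemma t))
        where
        lemma : ∀ t → suc (t ℕ.* 4) ℕ.* suc (t ℕ.* 4)
                    ≡.≡ suc ((t ℕ.* 4) ℕ.* suc (2 ℕ.* t) ℕ.+ (t ℕ.* 4) ℕ.* suc (2 ℕ.* t))
        lemma = solve-∀

    1≉-1 : ¬ 1# ≈ - 1#
    1≉-1 = odd-char⇒1≉-1 (t ℕ.* 2) (≡.subst (λ n → n × 1# ≈ 0#) (≡.trans s≡1+4t (≡.cong suc (lemma t))) s≈0)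
      where
      lemma : ∀ t → t ℕ.* 4 ≡.≡ t ℕ.* 2 ℕ.+ t ℕ.* 2
      lemma = solve-∀
      s≈0 : s × 1# ≈ 0#
      s≈0 = x*x≈0⇒x≈0 (trans (sym (×1-homo-* s s)) (≡.subst (λ n → n × 1# ≈ 0#) q≡s*s characteristic))

    norm-one-square^m : ∀ {a} → a ^ suc s ≈ 1# → (a * a) ^ m ≈ 1#
    norm-one-square^m {a} a^[1+s]≈1 = begin
      (a * a) ^ m      ≈⟨ ^-distrib-* a a m ⟩
      a ^ m * a ^ m    ≈⟨ ^-homo-* a m m ⟨
      a ^ (m ℕ.+ m)    ≡⟨ ≡.cong (a ^_) 1+s≡m+m ⟨
      a ^ suc s        ≈⟨ a^[1+s]≈1 ⟩
      1#               ∎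

    norm-one-square : ∀ {a} → a ^ suc s ≈ 1# → (a * a) ^ suc s ≈ 1#
    norm-one-square {a} a^[1+s]≈1 =
      trans (^-distrib-* a a (suc s)) (trans (*-cong a^[1+s]≈1 a^[1+s]≈1) (*-identityʳ 1#))

    -1^m≈-1 : (- 1#) ^ m ≈ - 1#
    -1^m≈-1 = begin
      - 1# * (- 1#) ^ (2 ℕ.* t)     ≈⟨ *-congˡ (^-assocʳ (- 1#) 2 t) ⟨
      - 1# * ((- 1#) ^ 2) ^ t       ≈⟨ *-congˡ (^-congˡ t (solve 0 (:- con (1 ⊝ 0) :* (:- con (1 ⊝ 0) :* con (1 ⊝ 0)) := con (1 ⊝ 0)) refl)) ⟩
      - 1# * 1# ^ t                 ≈⟨ *-congˡ (1^n≈1 t) ⟩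
      - 1# * 1#                     ≈⟨ *-identityʳ _ ⟩
      - 1#                          ∎

    -- a² = -b² is impossible, as raising to the odd power m gives 1 = -1.
    norm-one-sum-nonzero : ∀ {a b} → a ^ suc s ≈ 1# → b ^ suc s ≈ 1# → ¬ a * a + b * b ≈ 0#
    norm-one-sum-nonzero {a} {b} a^[1+s]≈1 b^[1+s]≈1 sum≈0 = 1≉-1 (begin
      1#                        ≈⟨ norm-one-square^m a^[1+s]≈1 ⟨
      (a * a) ^ m               ≈⟨ ^-congˡ m aa≈-bb ⟩
      (- 1# * (b * b)) ^ m      ≈⟨ ^-distrib-* (- 1#) (b * b) m ⟩
      (- 1#) ^ m * (b * b) ^ m  ≈⟨ *-cong -1^m≈-1 (norm-one-square^m b^[1+s]≈1) ⟩
      - 1# * 1#                 ≈⟨ *-identityʳ _ ⟩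
      - 1#                      ∎)
      where
      aa≈-bb : a * a ≈ - 1# * (b * b)
      aa≈-bb = begin
        a * a                             ≈⟨ solve 2 (λ a b → a :* a := (a :* a :+ b :* b) :+ :- con (1 ⊝ 0) :* (b :* b)) refl a b ⟩
        (a * a + b * b) + - 1# * (b * b)  ≈⟨ +-congʳ sum≈0 ⟩
        0# + - 1# * (b * b)               ≈⟨ +-identityˡ _ ⟩
        - 1# * (b * b)                    ∎

    -- With A = a², B = b²: (A + B) ^ s = A⁻¹ + B⁻¹, so (A + B) ^ (s - 1) = (AB)⁻¹, whose m-th
    -- power is 1; by Euler's criterion A + B cannot be a non-square.
    norm-one-sum-¬nonsquare : ∀ {a b} → a ^ suc s ≈ 1# → b ^ suc s ≈ 1# → ¬ ¬ IsSquare F (a * a + b * b)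
    norm-one-sum-¬nonsquare {a} {b} a^[1+s]≈1 b^[1+s]≈1 nonsquare =
      1≉-1 (trans (sym V^[rm]≈1) (euler 1≉-1 (r ℕ.* m) (≡.sym q≡1+2rm) nonsquare))
      where
      A B V : Carrier
      A = a * a
      B = b * b
      V = A + B
      V^s*AB≈V : V ^ s * (A * B) ≈ V
      V^s*AB≈V = begin
        V ^ s * (A * B)                        ≈⟨ *-congʳ (frobenius-s A B) ⟩
        (A ^ s + B ^ s) * (A * B)              ≈⟨ solve 4 (λ x y A B → (x :+ y) :* (A :* B) := (A :* x) :* B :+ (B :* y) :* A) refl (A ^ s) (B ^ s) A B ⟩
        A ^ suc s * B + B ^ suc s * A          ≈⟨ +-cong (*-congʳ (norm-one-square a^[1+s]≈1)) (*-congʳ (norm-one-square b^[1+s]≈1)) ⟩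
        1# * B + 1# * A                        ≈⟨ trans (+-cong (*-identityˡ B) (*-identityˡ A)) (+-comm B A) ⟩
        V                                      ∎
      V^r*AB≈1 : V ^ r * (A * B) ≈ 1#
      V^r*AB≈1 = x∙y⁻¹≈ε⇒x≈y _ _ (x*y≈0⇒y≈0 (norm-one-sum-nonzero a^[1+s]≈1 b^[1+s]≈1) (begin
        V * (V ^ r * (A * B) - 1#)     ≈⟨ solve 3 (λ v x w → v :* (x :* w :- con (1 ⊝ 0)) := (v :* x) :* w :- v) refl V (V ^ r) (A * B) ⟩
        V ^ suc r * (A * B) - V        ≡⟨ ≡.cong (λ n → V ^ n * (A * B) - V) s≡1+4t ⟨
        V ^ s * (A * B) - V            ≈⟨ +-congʳ V^s*AB≈V ⟩
        V - V                          ≈⟨ -‿inverseʳ V ⟩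
        0#                             ∎))
      AB^m≈1 : (A * B) ^ m ≈ 1#
      AB^m≈1 = begin
        (A * B) ^ m   ≈⟨ ^-distrib-* A B m ⟩
        A ^ m * B ^ m ≈⟨ *-cong (norm-one-square^m a^[1+s]≈1) (norm-one-square^m b^[1+s]≈1) ⟩
        1# * 1#       ≈⟨ *-identityʳ 1# ⟩
        1#            ∎
      V^[rm]≈1 : V ^ (r ℕ.* m) ≈ 1#
      V^[rm]≈1 = begin
        V ^ (r ℕ.* m)                  ≈⟨ ^-assocʳ V r m ⟨
        (V ^ r) ^ m                    ≈⟨ *-identityʳ _ ⟨
        (V ^ r) ^ m * 1#               ≈⟨ *-congˡ AB^m≈1 ⟨
        (V ^ r) ^ m * (A * B) ^ m      ≈⟨ ^-distrib-* (V ^ r) (A * B) m ⟨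
        (V ^ r * (A * B)) ^ m          ≈⟨ ^-congˡ m V^r*AB≈1 ⟩
        1# ^ m                         ≈⟨ 1^n≈1 m ⟩
        1#                             ∎

module InternalOrbits {q : ℕ} (F : FiniteField q) where
  open FiniteField F
  open FiniteFieldProperties F using (pow≈^; 1^n≈1)
  open import Algebra.Properties.Semiring.Exp semiring using (_^_)
  open Geometry F
  open NormOneSquares F

  no-orbit-point-on-polar :
    ∀ {s} t → s ≡.≡ suc (t ℕ.* 4) → q ≡.≡ s ℕ.* s → (∀ y z → (y + z) ^ s ≈ y ^ s + z ^ s) →
    ∀ x → (∀ a c → InK F s a c → Internal F (act F a c x)) →
    ∀ a c a′ c′ → InK F s a c → InK F s a′ c′ → ¬ OnPolar F (act F a c x) (act F a′ c′ x)
  no-orbit-point-on-polar {s} t s≡1+4t q≡s*s frobenius-s x internal a c a′ c′ a∈K a′∈K polar =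
    norm-one-sum-¬nonsquare (norm-one a∈K) (norm-one a′∈K) λ V-square →
      disc-nonsquare (square-ratio (norm-one-sum-nonzero (norm-one a∈K) (norm-one a′∈K))
                                   V-square (onPolar⇒square a c a′ c′ x polar))
    where
    open QuadraticExtension t s≡1+4t q≡s*s frobenius-s
    norm-one : ∀ {b} → pow F b (suc s) ≈ 1# → b ^ suc s ≈ 1#
    norm-one {b} b∈K = trans (sym (pow≈^ b (suc s))) b∈K
    disc-nonsquare : ¬ IsSquare F (disc x)
    disc-nonsquare (y , yy≈D) = proj₂ (internal 1# 0# (trans (pow≈^ 1# (suc s)) (1^n≈1 (suc s))))
      (y , trans yy≈D (sym (trans (disc-act 1# 0# x) (trans (*-congʳ (*-identityˡ 1#)) (*-identityˡ _)))))

open import Data.Nat using (ℕ; _^_; _*_; _%_; _≥_; suc)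
open import Data.Nat.Primality using (Prime)
open import Relation.Nullary using (¬_)
open import Relation.Binary.PropositionalEquality using (_≡_; _≢_)

theorem2p10 : (p e : ℕ) → Prime p → p ≢ 2 → e ≥ 1 → (p ^ e) % 4 ≡ 1 →
    (F : FiniteField (p ^ (2 * e))) →
    (x : Vec3 F) → IsPoint F x →
    (∀ a c → InK F (p ^ e) a c → Internal F (act F a c x)) →
    ∀ a c a′ c′ → InK F (p ^ e) a c → InK F (p ^ e) a′ c′ →
    ¬ OnPolar F (act F a c x) (act F a′ c′ x)
theorem2p10 p e p-prime _ _ s%4≡1 F x _ =
  InternalOrbits.no-orbit-point-on-polar F (p ^ e / 4) s≡1+4t q≡s*s
    (Frobenius.frobenius-^ (FiniteField.commutativeSemiring F) p-prime
       (FiniteFieldProperties.prime-power-characteristic F p (2 * e) ≡.refl) e) x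
  where
  s≡1+4t : p ^ e ≡ suc (p ^ e / 4 * 4)
  s≡1+4t = ≡.trans (m≡m%n+[m/n]*n (p ^ e) 4) (≡.cong (ℕ._+ (p ^ e / 4 * 4)) s%4≡1)
  q≡s*s : p ^ (2 * e) ≡ p ^ e * p ^ e
  q≡s*s = ≡.trans (ℕ.^-distribˡ-+-* p e (e ℕ.+ 0)) (≡.cong (λ n → p ^ e * p ^ n) (ℕ.+-identityʳ e))
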